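{- Every $P$-rack is a $G$-rack.
   Context: A rack is a set $R$ with a binary operation $\triangleright$ such that $a\triangleright(b\triangleright c)=(a\triangleright b)\triangleright(a\triangleright c)$ for all $a,b,c\in R$, and for all $a,b\in R$ there is a unique $x\in R$ with $a\triangleright x=b$. A subrack is a subset $Q$ such that $(Q,\triangleright)$ is a rack. For $a\in R$, $f_a:R\to R$ is the bijection $f_a(b)=a\triangleright b$; the inner group $\mathrm{Inn}(R)$ is the group generated by $\{f_a:a\in R\}$ under composition, and the orbits of $R$ are the orbits of the natural action of $\mathrm{Inn}(R)$ on $R$, i.e. the sets $\{\phi(x):\phi\in\mathrm{Inn}(R)\}$. A rack $R$ is a $G$-rack if $R$ is the only subrack of $R$ having nonempty intersection with every orbit of $R$. A $P$-rack is a rack of the following form: $R$ is a set with a partition $\{R_i\}_{i\in I}$, $\{f_i\}_{i\in I}$ is a family of permutations of $R$ with $f_i(R_j)=R_j$ and $f_if_j=f_jf_i$ for all $i,j\in I$, and $x\triangleright y=f_i(y)$ for all $x,y\in R$ where $i$ is the index with $x\in R_i$. -}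

module Defs where

open import Data.Product using (Σ; ∃; _×_; _,_)
open import Relation.Binary.PropositionalEquality using (_≡_)
open import Function.Definitions using (Bijective)

IsRack : (R : Set) → (R → R → R) → Set
IsRack R _▷_ =
  ((a b c : R) → a ▷ (b ▷ c) ≡ (a ▷ b) ▷ (a ▷ c)) ×
  ((a b : R) → Σ R λ x → (a ▷ x ≡ b) × ((y : R) → a ▷ y ≡ b → y ≡ x))

IsSubrack : (R : Set) → (R → R → R) → (R → Set) → Set
IsSubrack R _▷_ Q =
  ((a b : R) → Q a → Q b → Q (a ▷ b)) ×
  ((a b c : R) → Q a → Q b → Q c → a ▷ (b ▷ c) ≡ (a ▷ b) ▷ (a ▷ c)) ×
  ((a b : R) → Q a → Q b →
     Σ R λ x → Q x × (a ▷ x ≡ b) × ((y : R) → Q y → a ▷ y ≡ b → y ≡ x))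

-- SameOrbit x y : y = φ(x) for some φ in Inn(R), the group generated by the
-- maps f_a = a ▷ _ ; a word in the generators and their inverses.
data SameOrbit {R : Set} (_▷_ : R → R → R) (x : R) : R → Set where
  here  : SameOrbit _▷_ x x
  apply : (a y : R) → SameOrbit _▷_ x y → SameOrbit _▷_ x (a ▷ y)
  unapply : (a y z : R) → SameOrbit _▷_ x y → a ▷ z ≡ y → SameOrbit _▷_ x z

IsGRack : (R : Set) → (R → R → R) → Set₁
IsGRack R _▷_ =
  (Q : R → Set) → IsSubrack R _▷_ Q →
  ((x : R) → Σ R λ y → Q y × SameOrbit _▷_ x y) →
  (x : R) → Q x

-- P-rack: a partition of R into blocks R_i (i ∈ I), encoded by the block-index
-- map idx (x ∈ R_i iff idx x ≡ i), commuting permutations f_i with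
-- f_i(R_j) = R_j, and x ▷ y = f_{idx x}(y).
IsPRack : (R : Set) → (R → R → R) → Set₁
IsPRack R _▷_ =
  Σ Set λ I → Σ (R → I) λ idx → Σ (I → R → R) λ f →
    ((i : I) → Bijective _≡_ _≡_ (f i)) ×
    ((i : I) (y : R) → idx (f i y) ≡ idx y) ×
    ((i : I) (y : R) → Σ R λ z → (idx z ≡ idx y) × (f i z ≡ y)) ×
    ((i j : I) (y : R) → f i (f j y) ≡ f j (f i y)) ×
    ((x y : R) → x ▷ y ≡ f (idx x) y)

module Submission where

-- In a P-rack x ▷ y = f_{idx x}(y), and every f_i maps each block to
-- itself.  Hence the block index is invariant under every left
-- multiplication, so it is constant on orbits; consequently the map a ▷ _
-- depends only on the orbit of a.  Now let Q be a subrack meeting every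
-- orbit.  For any a choose q ∈ Q in the orbit of a; then a ▷ _ = q ▷ _,
-- so Q is closed under a ▷ _ (because it is closed under ▷) and under its
-- preimage (because Q is closed under left division by q and q ▷ _ is
-- injective).  A predicate closed under every f_a and every f_a⁻¹ is a
-- union of orbits; since every orbit contains a point of Q, Q is all of R.

open import Defs
open import Data.Product using (Σ; _×_; _,_; proj₁)
open import Relation.Binary.PropositionalEquality using (_≡_; refl; sym; trans; cong; subst)
open import Function.Definitions using (Injective)

module Orbits {R : Set} (_▷_ : R → R → R) where

  invariant-on-orbits : {B : Set} (h : R → B) → ((a y : R) → h (a ▷ y) ≡ h y) →
                        {x y : R} → SameOrbit _▷_ x y → h y ≡ h x
  invariant-on-orbits h inv here = refl
  invariant-on-orbits h inv (apply a y p) = trans (inv a y) (invariant-on-orbits h inv p)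
  invariant-on-orbits h inv (unapply a y z p e) =
    trans (sym (inv a z)) (trans (cong h e) (invariant-on-orbits h inv p))

  saturated-contains-orbit : (Q : R → Set) →
                             ((a y : R) → Q y → Q (a ▷ y)) →
                             ((a z : R) → Q (a ▷ z) → Q z) →
                             {x y : R} → SameOrbit _▷_ x y → Q y → Q x
  saturated-contains-orbit Q closed preimage here qy = qy
  saturated-contains-orbit Q closed preimage (apply a y p) qay =
    saturated-contains-orbit Q closed preimage p (preimage a y qay)
  saturated-contains-orbit Q closed preimage (unapply a y z p e) qz =
    saturated-contains-orbit Q closed preimage p (subst Q e (closed a z qz))

module PRack {R : Set} (_▷_ : R → R → R) {I : Set} (idx : R → I) (f : I → R → R)
             (injective : (i : I) → Injective _≡_ _≡_ (f i))
             (preserves-blocks : (i : I) (y : R) → idx (f i y) ≡ idx y)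
             (op : (x y : R) → x ▷ y ≡ f (idx x) y) where

  open Orbits _▷_

  block-constant-on-orbits : {a b : R} → SameOrbit _▷_ a b → idx b ≡ idx a
  block-constant-on-orbits =
    invariant-on-orbits idx (λ a y → trans (cong idx (op a y)) (preserves-blocks (idx a) y))

  translation-constant-on-orbits : {a b : R} → SameOrbit _▷_ a b → (y : R) → a ▷ y ≡ b ▷ y
  translation-constant-on-orbits a~b y =
    trans (op _ y) (trans (cong (λ i → f i y) (sym (block-constant-on-orbits a~b))) (sym (op _ y)))

  left-cancel : (q : R) {u v : R} → q ▷ u ≡ q ▷ v → u ≡ v
  left-cancel q {u} {v} e = injective (idx q) (trans (sym (op q u)) (trans e (op q v)))

  -- A subrack meeting every orbit is closed under all f_a and f_a⁻¹: replace
  -- a by a representative q ∈ Q of its orbit, for which a ▷ _ = q ▷ _.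
  module _ (Q : R → Set) (meets : (x : R) → Σ R λ y → Q y × SameOrbit _▷_ x y) where

    subrack-closed : IsSubrack R _▷_ Q → (a y : R) → Q y → Q (a ▷ y)
    subrack-closed (closed , _) a y qy with meets a
    ... | q , qq , a~q =
      subst Q (sym (translation-constant-on-orbits a~q y)) (closed q y qq qy)

    subrack-preimage : IsSubrack R _▷_ Q → (a z : R) → Q (a ▷ z) → Q z
    subrack-preimage (_ , _ , divide) a z qaz with meets a
    ... | q , qq , a~q with divide q (a ▷ z) qq qaz
    ...   | w , qw , qw≡az , _ =
      subst Q (left-cancel q (trans qw≡az (translation-constant-on-orbits a~q z))) qw

proposition4p1 : (R : Set) (_▷_ : R → R → R) → IsRack R _▷_ → IsPRack R _▷_ → IsGRack R _▷_
proposition4p1 R _▷_ _ (I , idx , f , bijective , preserves-blocks , _ , _ , op) Q subrack meets x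
  with meets x
... | y , qy , x~y =
  saturated-contains-orbit Q (subrack-closed Q meets subrack) (subrack-preimage Q meets subrack) x~y qy
  where
  open Orbits _▷_
  open PRack _▷_ idx f (λ i → proj₁ (bijective i)) preserves-blocks op
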